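{- Let $G$ be a strongly connected digraph with diameter at most $2$ that contains the pattern $\mathcal{F}_1$, i.e. there are four distinct vertices $u,v,w,z$ of $G$ such that $(u,v)$ and $(v,w)$ are arcs of $G$ while $(u,w)$, $(u,z)$ and $(v,z)$ are not arcs of $G$. Then $I_2(G)=\langle 1\rangle$.
   Context: A digraph is simple: no loops and no multiple arcs. It is strongly connected if for all vertices $u,v$ there is a directed $uv$-walk. $\operatorname{dist}(u,v)$ is the number of arcs of a shortest directed $uv$-walk; the diameter is the maximum distance. $D_X(G)=\operatorname{diag}(x_u)_{u\in V(G)}+D(G)$, where $D(G)$ is the distance matrix and $x_u$ are indeterminates; $I_2(G)$ is the ideal of $\mathbb{Z}[x_u:u\in V(G)]$ generated by all $2\times 2$ minors of $D_X(G)$. Pairs of vertices not mentioned in the pattern are unconstrained. -}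

module Defs where

open import Data.Nat as ℕ using (ℕ; zero; suc; _<_; _≤_)
open import Data.Integer as ℤ using (ℤ; +_)
open import Data.Fin using (Fin; toℕ; _≟_)
open import Data.Bool using (Bool; true; false; if_then_else_)
open import Data.Product using (_×_; ∃; ∃-syntax; _,_)
open import Relation.Nullary using (¬_)
open import Relation.Nullary.Decidable using (⌊_⌋)
open import Relation.Binary.PropositionalEquality using (_≡_; _≢_)

record Digraph (n : ℕ) : Set where
  field
    adj     : Fin n → Fin n → Bool
    noLoops : ∀ u → adj u u ≡ false

Arc : ∀ {n} → Digraph n → Fin n → Fin n → Set
Arc G u v = Digraph.adj G u v ≡ true

data Walk {n} (G : Digraph n) : Fin n → Fin n → ℕ → Set where
  here : ∀ {u} → Walk G u u 0
  step : ∀ {u w v k} → Arc G u w → Walk G w v k → Walk G u v (suc k)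

StronglyConnected : ∀ {n} → Digraph n → Set
StronglyConnected G = ∀ u v → ∃[ k ] Walk G u v k

IsDistance : ∀ {n} → Digraph n → (Fin n → Fin n → ℕ) → Set
IsDistance G d = ∀ u v → Walk G u v (d u v) × (∀ k → Walk G u v k → d u v ≤ k)

DiameterAtMost2 : ∀ {n} → (Fin n → Fin n → ℕ) → Set
DiameterAtMost2 d = ∀ u v → d u v ≤ 2

ContainsF1 : ∀ {n} → Digraph n → Set
ContainsF1 G = ∃[ u ] ∃[ v ] ∃[ w ] ∃[ z ]
  ((u ≢ v × u ≢ w × u ≢ z × v ≢ w × v ≢ z × w ≢ z)
  × Arc G u v × Arc G v w
  × ¬ Arc G u w × ¬ Arc G u z × ¬ Arc G v z)

-- The polynomial ring ℤ[x_u : u ∈ Fin n], presented as the free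
-- commutative ℤ-algebra on the variables: ring expressions modulo the
-- congruence generated by the commutative ring axioms and the
-- homomorphism laws for integer constants.

data Poly (n : ℕ) : Set where
  con  : ℤ → Poly n
  var  : Fin n → Poly n
  _⊕_  : Poly n → Poly n → Poly n
  _⊗_  : Poly n → Poly n → Poly n
  ⊝_   : Poly n → Poly n

infixl 6 _⊕_
infixl 7 _⊗_
infix 8 ⊝_
infix 4 _≈_

data _≈_ {n} : Poly n → Poly n → Set where
  ≈-refl  : ∀ {p} → p ≈ p
  ≈-sym   : ∀ {p q} → p ≈ q → q ≈ p
  ≈-trans : ∀ {p q r} → p ≈ q → q ≈ r → p ≈ r
  ⊕-cong  : ∀ {p p′ q q′} → p ≈ p′ → q ≈ q′ → p ⊕ q ≈ p′ ⊕ q′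
  ⊗-cong  : ∀ {p p′ q q′} → p ≈ p′ → q ≈ q′ → p ⊗ q ≈ p′ ⊗ q′
  ⊝-cong  : ∀ {p q} → p ≈ q → ⊝ p ≈ ⊝ q
  ⊕-assoc : ∀ p q r → (p ⊕ q) ⊕ r ≈ p ⊕ (q ⊕ r)
  ⊕-comm  : ∀ p q → p ⊕ q ≈ q ⊕ p
  ⊕-idˡ   : ∀ p → con (+ 0) ⊕ p ≈ p
  ⊝-invˡ  : ∀ p → (⊝ p) ⊕ p ≈ con (+ 0)
  ⊗-assoc : ∀ p q r → (p ⊗ q) ⊗ r ≈ p ⊗ (q ⊗ r)
  ⊗-comm  : ∀ p q → p ⊗ q ≈ q ⊗ p
  ⊗-idˡ   : ∀ p → con (+ 1) ⊗ p ≈ p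
  distribˡ : ∀ p q r → p ⊗ (q ⊕ r) ≈ (p ⊗ q) ⊕ (p ⊗ r)
  con-⊕   : ∀ a b → con (a ℤ.+ b) ≈ con a ⊕ con b
  con-⊗   : ∀ a b → con (a ℤ.* b) ≈ con a ⊗ con b
  con-⊝   : ∀ a → con (ℤ.- a) ≈ ⊝ con a

data InIdeal {n} (Gen : Poly n → Set) : Poly n → Set where
  gen  : ∀ {p} → Gen p → InIdeal Gen p
  zer  : InIdeal Gen (con (+ 0))
  add  : ∀ {p q} → InIdeal Gen p → InIdeal Gen q → InIdeal Gen (p ⊕ q)
  mul  : ∀ r {p} → InIdeal Gen p → InIdeal Gen (r ⊗ p)
  resp : ∀ {p q} → p ≈ q → InIdeal Gen p → InIdeal Gen q

DX : ∀ {n} → (Fin n → Fin n → ℕ) → Fin n → Fin n → Poly n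
DX d i j = (if ⌊ i ≟ j ⌋ then var i else con (+ 0)) ⊕ con (+ d i j)

minor2 : ∀ {n} → (Fin n → Fin n → Poly n) → Fin n → Fin n → Fin n → Fin n → Poly n
minor2 M i j k l = (M i k ⊗ M j l) ⊕ ⊝ (M i l ⊗ M j k)

Is2Minor : ∀ {n} → (Fin n → Fin n → ℕ) → Poly n → Set
Is2Minor d p = ∃[ i ] ∃[ j ] ∃[ k ] ∃[ l ]
  (toℕ i < toℕ j × toℕ k < toℕ l × p ≡ minor2 (DX d) i j k l)

I₂IsTrivial : ∀ {n} → (Fin n → Fin n → ℕ) → Set
I₂IsTrivial d = InIdeal (Is2Minor d) (con (+ 1))

-- Everything happens in the 2 × 3 submatrix of D_X(G) on rows u, v and
-- columns v, w, z.  Arcs give d(u,v) = d(v,w) = 1, and since the diameter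
-- is at most 2 the non-arcs give d(u,w) = d(u,z) = d(v,z) = 2.  Hence the
-- minors on columns {v,z} and {v,w} are 2 - 2 D_X(v,v) and 1 - 2 D_X(v,v),
-- and their difference is 1.
module Submission where

open import Data.Nat as ℕ using (ℕ; suc; s≤s)
open import Data.Integer as ℤ using (+_)
open import Data.Fin using (Fin; toℕ; _≟_)
open import Data.Fin.Properties using (<-cmp)
open import Data.Product using (_,_; proj₁; proj₂)
open import Data.Empty using (⊥-elim)
open import Relation.Nullary using (¬_; yes; no)
open import Relation.Binary using (Setoid; tri<; tri≈; tri>)
open import Relation.Binary.PropositionalEquality using (_≡_; _≢_; refl)
open import Algebra.Bundles using (AbelianGroup; CommutativeRing)
open import Algebra.Structures using (IsCommutativeRing)
import Algebra.Consequences.Setoid as Consequences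
import Algebra.Properties.AbelianGroup as AbelianGroupProperties
import Algebra.Properties.Ring as RingProperties
import Relation.Binary.Reasoning.Setoid as SetoidReasoning
open import Level using (0ℓ)

module _ {a ℓ} (G : AbelianGroup a ℓ) where
  open AbelianGroup G
  open AbelianGroupProperties G using (⁻¹-anti-homo‿-)
  open SetoidReasoning setoid

  [x-z]-[y-z]≈x-y : ∀ x y z → (x - z) - (y - z) ≈ x - y
  [x-z]-[y-z]≈x-y x y z = begin
    (x - z) - (y - z)        ≈⟨ ∙-congˡ (⁻¹-anti-homo‿- y z) ⟩
    (x - z) ∙ (z - y)        ≈⟨ assoc x (z ⁻¹) (z - y) ⟩
    x ∙ (z ⁻¹ ∙ (z - y))     ≈⟨ ∙-congˡ (assoc (z ⁻¹) z (y ⁻¹)) ⟨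
    x ∙ ((z ⁻¹ ∙ z) ∙ y ⁻¹)  ≈⟨ ∙-congˡ (∙-congʳ (inverseˡ z)) ⟩
    x ∙ (ε ∙ y ⁻¹)           ≈⟨ ∙-congˡ (identityˡ (y ⁻¹)) ⟩
    x - y                    ∎

module _ {c ℓ} (R : CommutativeRing c ℓ) where
  open CommutativeRing R
  open AbelianGroupProperties +-abelianGroup using (⁻¹-anti-homo‿-)
  open SetoidReasoning setoid

  xy-zw≈-[wz-yx] : ∀ x y z w → x * y - z * w ≈ - (w * z - y * x)
  xy-zw≈-[wz-yx] x y z w = begin
    x * y - z * w      ≈⟨ +-cong (*-comm x y) (-‿cong (*-comm z w)) ⟩
    y * x - w * z      ≈⟨ ⁻¹-anti-homo‿- (w * z) (y * x) ⟨
    - (w * z - y * x)  ∎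

open import Defs

module _ {n : ℕ} where
  Poly-setoid : Setoid 0ℓ 0ℓ
  Poly-setoid = record
    { Carrier = Poly n
    ; _≈_ = _≈_
    ; isEquivalence = record { refl = ≈-refl ; sym = ≈-sym ; trans = ≈-trans }
    }

  open Consequences Poly-setoid using (comm∧idˡ⇒id; comm∧invˡ⇒inv; comm∧distrˡ⇒distr)

  Poly-isCommutativeRing : IsCommutativeRing _≈_ _⊕_ _⊗_ ⊝_ (con (+ 0)) (con (+ 1))
  Poly-isCommutativeRing = record
    { isRing = record
      { +-isAbelianGroup = record
        { isGroup = record
          { isMonoid = record
            { isSemigroup = record
              { isMagma = record
                { isEquivalence = Setoid.isEquivalence Poly-setoid
                ; ∙-cong = ⊕-cong
                }
              ; assoc = ⊕-assoc
              }
            ; identity = comm∧idˡ⇒id ⊕-comm ⊕-idˡ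
            }
          ; inverse = comm∧invˡ⇒inv ⊕-comm ⊝-invˡ
          ; ⁻¹-cong = ⊝-cong
          }
        ; comm = ⊕-comm
        }
      ; *-cong = ⊗-cong
      ; *-assoc = ⊗-assoc
      ; *-identity = comm∧idˡ⇒id ⊗-comm ⊗-idˡ
      ; distrib = comm∧distrˡ⇒distr ⊕-cong ⊗-comm distribˡ
      }
    ; *-comm = ⊗-comm
    }

Poly-commutativeRing : ℕ → CommutativeRing 0ℓ 0ℓ
Poly-commutativeRing n = record { isCommutativeRing = Poly-isCommutativeRing {n} }

module _ {n : ℕ} where
  open CommutativeRing (Poly-commutativeRing n) using (ring; +-abelianGroup)
  open RingProperties ring using (-1*x≈-x; x[y-z]≈xy-xz)
  open AbelianGroupProperties +-abelianGroup using (⁻¹-anti-homo‿-)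
  open SetoidReasoning (Poly-setoid {n})

  InIdeal-⊝ : ∀ {Gen : Poly n → Set} {p} → InIdeal Gen p → InIdeal Gen (⊝ p)
  InIdeal-⊝ {p = p} p∈I = resp (-1*x≈-x p) (mul (⊝ con (+ 1)) p∈I)

  InIdeal-difference : ∀ {Gen : Poly n → Set} {p q} →
    InIdeal Gen p → InIdeal Gen q → InIdeal Gen (p ⊕ ⊝ q)
  InIdeal-difference p∈I q∈I = add p∈I (InIdeal-⊝ q∈I)

  module _ (M : Fin n → Fin n → Poly n) where
    minor2-swapColumns : ∀ i j k l → minor2 M i j k l ≈ ⊝ minor2 M i j l k
    minor2-swapColumns i j k l = ≈-sym (⁻¹-anti-homo‿- (M i l ⊗ M j k) (M i k ⊗ M j l))

    minor2-swapRows : ∀ i j k l → minor2 M i j k l ≈ ⊝ minor2 M j i k l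
    minor2-swapRows i j k l = xy-zw≈-[wz-yx] (Poly-commutativeRing n) _ _ _ _

    minor2-differenceʳ : ∀ i j k l l′ → M i l ≈ M i l′ →
      minor2 M i j k l ⊕ ⊝ minor2 M i j k l′ ≈ M i k ⊗ (M j l ⊕ ⊝ M j l′)
    minor2-differenceʳ i j k l l′ eq = begin
      minor2 M i j k l ⊕ ⊝ minor2 M i j k l′
        ≈⟨ ⊕-cong (⊕-cong ≈-refl (⊝-cong (⊗-cong eq ≈-refl))) ≈-refl ⟩
      (M i k ⊗ M j l ⊕ ⊝ c) ⊕ ⊝ (M i k ⊗ M j l′ ⊕ ⊝ c)
        ≈⟨ [x-z]-[y-z]≈x-y +-abelianGroup (M i k ⊗ M j l) (M i k ⊗ M j l′) c ⟩
      M i k ⊗ M j l ⊕ ⊝ (M i k ⊗ M j l′)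
        ≈⟨ x[y-z]≈xy-xz (M i k) (M j l) (M j l′) ⟨
      M i k ⊗ (M j l ⊕ ⊝ M j l′) ∎
      where
      c : Poly n
      c = M i l′ ⊗ M j k

  module _ (d : Fin n → Fin n → ℕ) where
    minor2∈I₂-rowsOrdered : ∀ {i j k l} → toℕ i ℕ.< toℕ j → k ≢ l →
      InIdeal (Is2Minor d) (minor2 (DX d) i j k l)
    minor2∈I₂-rowsOrdered {i} {j} {k} {l} i<j k≢l with <-cmp k l
    ... | tri< k<l _ _ = gen (i , j , k , l , i<j , k<l , refl)
    ... | tri≈ _ k≡l _ = ⊥-elim (k≢l k≡l)
    ... | tri> _ _ l<k = resp (≈-sym (minor2-swapColumns (DX d) i j k l))
                           (InIdeal-⊝ (gen (i , j , l , k , i<j , l<k , refl)))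

    minor2∈I₂ : ∀ {i j k l} → i ≢ j → k ≢ l → InIdeal (Is2Minor d) (minor2 (DX d) i j k l)
    minor2∈I₂ {i} {j} {k} {l} i≢j k≢l with <-cmp i j
    ... | tri< i<j _ _ = minor2∈I₂-rowsOrdered i<j k≢l
    ... | tri≈ _ i≡j _ = ⊥-elim (i≢j i≡j)
    ... | tri> _ _ j<i = resp (≈-sym (minor2-swapRows (DX d) i j k l))
                           (InIdeal-⊝ (minor2∈I₂-rowsOrdered j<i k≢l))

    DX-offDiagonal : ∀ {i j k} → i ≢ j → d i j ≡ k → DX d i j ≈ con (+ k)
    DX-offDiagonal {i} {j} i≢j refl with i ≟ j
    ... | yes i≡j = ⊥-elim (i≢j i≡j)
    ... | no _ = ⊕-idˡ (con (+ d i j))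

module _ {n} {G : Digraph n} where
  Walk-length0⇒≡ : ∀ {u v} → Walk G u v 0 → u ≡ v
  Walk-length0⇒≡ here = refl

  Walk-length1⇒Arc : ∀ {u v} → Walk G u v 1 → Arc G u v
  Walk-length1⇒Arc (step uv here) = uv

  module _ {d : Fin n → Fin n → ℕ} (isDist : IsDistance G d) where
    distance-arc : ∀ {u v} → u ≢ v → Arc G u v → d u v ≡ 1
    distance-arc {u} {v} u≢v uv
      with d u v | proj₁ (isDist u v) | proj₂ (isDist u v) 1 (step uv here)
    ... | 0 | walk | _ = ⊥-elim (u≢v (Walk-length0⇒≡ walk))
    ... | 1 | _ | _ = refl
    ... | suc (suc _) | _ | s≤s ()

    distance-nonArc : DiameterAtMost2 d → ∀ {u v} → u ≢ v → ¬ Arc G u v → d u v ≡ 2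
    distance-nonArc diam {u} {v} u≢v ¬uv with d u v | proj₁ (isDist u v) | diam u v
    ... | 0 | walk | _ = ⊥-elim (u≢v (Walk-length0⇒≡ walk))
    ... | 1 | walk | _ = ⊥-elim (¬uv (Walk-length1⇒Arc walk))
    ... | 2 | _ | _ = refl
    ... | suc (suc (suc _)) | _ | s≤s (s≤s ())

lemma9 : (n : ℕ) (G : Digraph n) (d : Fin n → Fin n → ℕ) →
    StronglyConnected G → IsDistance G d → DiameterAtMost2 d →
    ContainsF1 G → I₂IsTrivial d
lemma9 n G d _ isDist diam
  (u , v , w , z , (u≢v , u≢w , u≢z , v≢w , v≢z , _) , uv , vw , ¬uw , ¬uz , ¬vz) =
  resp minors-differ-by-1 (InIdeal-difference (minor2∈I₂ d u≢v v≢z) (minor2∈I₂ d u≢v v≢w))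
  where
  open SetoidReasoning (Poly-setoid {n})

  arc : ∀ {i j} → i ≢ j → Arc G i j → DX d i j ≈ con (+ 1)
  arc i≢j ij = DX-offDiagonal d i≢j (distance-arc isDist i≢j ij)

  nonArc : ∀ {i j} → i ≢ j → ¬ Arc G i j → DX d i j ≈ con (+ 2)
  nonArc i≢j ¬ij = DX-offDiagonal d i≢j (distance-nonArc isDist diam i≢j ¬ij)

  minors-differ-by-1 : minor2 (DX d) u v v z ⊕ ⊝ minor2 (DX d) u v v w ≈ con (+ 1)
  minors-differ-by-1 = begin
    minor2 (DX d) u v v z ⊕ ⊝ minor2 (DX d) u v v w
      ≈⟨ minor2-differenceʳ (DX d) u v v z w (≈-trans (nonArc u≢z ¬uz) (≈-sym (nonArc u≢w ¬uw))) ⟩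
    DX d u v ⊗ (DX d v z ⊕ ⊝ DX d v w)
      ≈⟨ ⊗-cong (arc u≢v uv) (⊕-cong (nonArc v≢z ¬vz) (⊝-cong (arc v≢w vw))) ⟩
    con (+ 1) ⊗ (con (+ 2) ⊕ ⊝ con (+ 1))
      ≈⟨ ⊗-idˡ _ ⟩
    con (+ 2) ⊕ ⊝ con (+ 1)
      ≈⟨ ⊕-cong ≈-refl (con-⊝ (+ 1)) ⟨
    con (+ 2) ⊕ con (ℤ.- + 1)
      ≈⟨ con-⊕ (+ 2) (ℤ.- + 1) ⟨
    con (+ 1) ∎
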